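{- Every formula of $\mathrm{ML}_{\vee,\Diamond}(\mathrm{NE})$ and of $\mathrm{ML}_{\vee,\Diamond^g}(\mathrm{NE})$ is convex and union closed.
   Context: Kripke model $M=(W,R,V)$ over $\mathsf X\subseteq\mathsf P$: $W\neq\emptyset$, $R\subseteq W\times W$, $V:\mathsf X\to\wp(W)$; a team is any $t\subseteq W$. $R[w]=\{v:wRv\}$, $R[t]=\bigcup_{w\in t}R[w]$, $R^{ -1}[s]=\{v:\exists w\in s,\ vRw\}$, and $tRs$ iff $s\subseteq R[t]$ and $t\subseteq R^{ -1}[s]$. Languages: $\mathrm{ML}_{\vee,\Diamond}$: $\alpha::=p\mid\bot\mid\alpha\wedge\alpha\mid\alpha\vee\alpha\mid\neg\alpha\mid\Diamond\alpha\mid\Box\alpha$; $\mathrm{ML}_{\vee,\Diamond}(\mathrm{NE})$: $\varphi::=p\mid\bot\mid\varphi\wedge\varphi\mid\varphi\vee\varphi\mid\neg\alpha\mid\mathrm{NE}\mid\Diamond\varphi\mid\Box\varphi$ ($\alpha\in\mathrm{ML}_{\vee,\Diamond}$); $\mathrm{ML}_{\vee,\Diamond^g}$ and $\mathrm{ML}_{\vee,\Diamond^g}(\mathrm{NE})$ are the same with $\Diamond^g,\Box^g$ in place of $\Diamond,\Box$. Truth $M,t\models\varphi$: $p$: $t\subseteq V(p)$; $\bot$: $t=\emptyset$; $\neg\alpha$: $M,\{w\}\not\models\alpha$ for all $w\in t$; $\wedge$: both; $\varphi\vee\psi$: $t=s\cup u$ with $M,s\models\varphi$, $M,u\models\psi$;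 $\mathrm{NE}$: $t\neq\emptyset$; $\Diamond\varphi$: for every $w\in t$ some nonempty $s\subseteq R[w]$ has $M,s\models\varphi$; $\Box\varphi$: for every $w\in t$, $M,R[w]\models\varphi$; $\Diamond^g\varphi$: some $s\subseteq W$ with $tRs$ has $M,s\models\varphi$; $\Box^g\varphi$: $M,R[t]\models\varphi$. A formula is convex if for every model $M$ and teams $s\subseteq u\subseteq t$, truth in $s$ and $t$ implies truth in $u$; union closed if for every model $M$ and nonempty set $\mathcal T$ of teams on $M$ in each of which it is true, it is true in $\bigcup\mathcal T$. -}

module Defs where

open import Data.Nat using (ℕ)
open import Level using (Lift; suc; zero)
open import Data.Bool using (Bool; true; false)
open import Data.Product using (Σ; _×_; ∃)
open import Data.Sum using (_⊎_)
open import Data.Empty using (⊥)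
open import Relation.Nullary using (¬_)
open import Relation.Binary.PropositionalEquality using (_≡_)

-- Kripke models.  Propositional symbols are indexed by ℕ; V is total on them
-- (X = all symbols).  W is nonempty (witnessed by `point`).
record Model : Set₁ where
  field
    W     : Set
    point : W
    R     : W → W → Set
    V     : ℕ → W → Set

Team : Model → Set₁
Team M = Model.W M → Set

module Ops (M : Model) where
  open Model M

  _⊆_ : Team M → Team M → Set
  s ⊆ t = ∀ w → s w → t w

  _∪_ : Team M → Team M → Team M
  (s ∪ t) w = s w ⊎ t w

  _≐_ : Team M → Team M → Set
  s ≐ t = (s ⊆ t) × (t ⊆ s)

  Empty : Team M → Set
  Empty t = ∀ w → ¬ t w

  NonEmpty : Team M → Set
  NonEmpty t = Σ W t

  singleton : W → Team M
  singleton w v = v ≡ w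

  succ : W → Team M
  succ w v = R w v

  image : Team M → Team M
  image t v = Σ W λ w → t w × R w v

  preimage : Team M → Team M
  preimage s v = Σ W λ w → s w × R v w

  TeamR : Team M → Team M → Set
  TeamR t s = (s ⊆ image t) × (t ⊆ preimage s)

  ⋃ : {I : Set} → (I → Team M) → Team M
  ⋃ {I} T w = Σ I λ i → T i w

data Mode : Set where
  local global : Mode

-- Fm m b : formulas; b = true allows NE, b = false gives the classical
-- fragment α (no NE), which is what may occur under ¬.
-- Fm local true  = ML_{∨,◇}(NE),   Fm global true = ML_{∨,◇ᵍ}(NE),
-- Fm local false = ML_{∨,◇},       Fm global false = ML_{∨,◇ᵍ}.
data Fm : Mode → Bool → Set where
  atom : ∀ {m b} → ℕ → Fm m b
  ⊥f   : ∀ {m b} → Fm m b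
  _∧f_ : ∀ {m b} → Fm m b → Fm m b → Fm m b
  _∨f_ : ∀ {m b} → Fm m b → Fm m b → Fm m b
  ¬f_  : ∀ {m b} → Fm m false → Fm m b
  NE   : ∀ {m} → Fm m true
  ◇_   : ∀ {b} → Fm local b → Fm local b
  □_   : ∀ {b} → Fm local b → Fm local b
  ◇ᵍ_  : ∀ {b} → Fm global b → Fm global b
  □ᵍ_  : ∀ {b} → Fm global b → Fm global b

_,_⊨_ : ∀ {m b} (M : Model) → Team M → Fm m b → Set₁
M , t ⊨ atom p   = Lift (suc zero) (Ops._⊆_ M t (Model.V M p))
M , t ⊨ ⊥f       = Lift (suc zero) (Ops.Empty M t)
M , t ⊨ (φ ∧f ψ) = (M , t ⊨ φ) × (M , t ⊨ ψ)
M , t ⊨ (φ ∨f ψ) = Σ (Team M) λ s → Σ (Team M) λ u →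
                     Lift (suc zero) (Ops._≐_ M t (Ops._∪_ M s u)) × (M , s ⊨ φ) × (M , u ⊨ ψ)
M , t ⊨ (¬f α)   = ∀ w → t w → ¬ (M , Ops.singleton M w ⊨ α)
M , t ⊨ NE       = Lift (suc zero) (Ops.NonEmpty M t)
M , t ⊨ (◇ φ)    = ∀ w → t w → Σ (Team M) λ s →
                     Lift (suc zero) (Ops.NonEmpty M s × Ops._⊆_ M s (Ops.succ M w)) × (M , s ⊨ φ)
M , t ⊨ (□ φ)    = ∀ w → t w → M , Ops.succ M w ⊨ φ
M , t ⊨ (◇ᵍ φ)   = Σ (Team M) λ s → Lift (suc zero) (Ops.TeamR M t s) × (M , s ⊨ φ)
M , t ⊨ (□ᵍ φ)   = M , Ops.image M t ⊨ φ

Convex : ∀ {m b} → Fm m b → Set₁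
Convex φ = ∀ (M : Model) (s u t : Team M) → Ops._⊆_ M s u → Ops._⊆_ M u t →
           M , s ⊨ φ → M , t ⊨ φ → M , u ⊨ φ

-- closure under unions of nonempty sets of teams (given as nonempty indexed families)
UnionClosed : ∀ {m b} → Fm m b → Set₁
UnionClosed φ = ∀ (M : Model) (I : Set) → I → (T : I → Team M) →
                (∀ i → M , T i ⊨ φ) → M , Ops.⋃ M T ⊨ φ

-- Atoms, ⊥, ¬, ◇ and □ are evaluated pointwise on the team, NE is upward closed
-- and □ᵍ reduces to its subformula on R[t]; the content lies in ∨ and ◇ᵍ.  There,
-- given s ⊆ u ⊆ t with witnesses sᵢ for s and tᵢ for t, the witnesses for u are
-- sᵢ ∪ (tᵢ ∩ u) (resp. s' ∪ (t' ∩ R[u])): they lie between sᵢ and sᵢ ∪ tᵢ, so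
-- convexity of the subformula applies once union closure has put it in sᵢ ∪ tᵢ.
module Submission where

open import Defs
open import Data.Bool using (Bool; true; false)
open import Data.Product using (_×_; _,_; proj₁; proj₂)
open import Data.Sum using (inj₁; inj₂)
open import Function using (_∘_)
open import Level using (lift; lower)

module _ (M : Model) where
  open Ops M

  ConvexIn UnionClosedIn : ∀ {m b} → Fm m b → Set₁
  ConvexIn φ = ∀ s u t → s ⊆ u → u ⊆ t → M , s ⊨ φ → M , t ⊨ φ → M , u ⊨ φ
  UnionClosedIn φ = ∀ I → I → (T : I → Team M) → (∀ i → M , T i ⊨ φ) → M , ⋃ T ⊨ φ

  _∩_ : Team M → Team M → Team M
  (s ∩ t) w = s w × t w

  image-mono : ∀ {s t} → s ⊆ t → image s ⊆ image t
  image-mono s⊆t v (w , sw , wRv) = w , s⊆t w sw , wRv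

  image-⋃ : ∀ {I} (T : I → Team M) → ⋃ (image ∘ T) ≐ image (⋃ T)
  image-⋃ T = (λ { v (j , w , Tjw , wRv) → w , (j , Tjw) , wRv })
            , (λ { v (w , (j , Tjw) , wRv) → j , w , Tjw , wRv })

  ⋃-Bool : ∀ (s t : Team M) → ⋃ (λ { true → s ; false → t }) ≐ (s ∪ t)
  ⋃-Bool s t = (λ { w (true , x) → inj₁ x ; w (false , x) → inj₂ x })
             , (λ { w (inj₁ x) → true , x ; w (inj₂ x) → false , x })

  ⊨-cong : ∀ {m b} (φ : Fm m b) {s t : Team M} → s ≐ t → M , s ⊨ φ → M , t ⊨ φ
  ⊨-cong (atom p) (_ , t⊆s) (lift h) = lift (λ w → h w ∘ t⊆s w)
  ⊨-cong ⊥f (_ , t⊆s) (lift h) = lift (λ w → h w ∘ t⊆s w)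
  ⊨-cong (φ ∧f ψ) s≐t (hφ , hψ) = ⊨-cong φ s≐t hφ , ⊨-cong ψ s≐t hψ
  ⊨-cong (φ ∨f ψ) (s⊆t , t⊆s) (s₁ , s₂ , lift (s⊆∪ , ∪⊆s) , h₁ , h₂) =
    s₁ , s₂ , lift ((λ w → s⊆∪ w ∘ t⊆s w) , (λ w → s⊆t w ∘ ∪⊆s w)) , h₁ , h₂
  ⊨-cong (¬f α) (_ , t⊆s) h w = h w ∘ t⊆s w
  ⊨-cong NE (s⊆t , _) (lift (w , sw)) = lift (w , s⊆t w sw)
  ⊨-cong (◇ φ) (_ , t⊆s) h w = h w ∘ t⊆s w
  ⊨-cong (□ φ) (_ , t⊆s) h w = h w ∘ t⊆s w
  ⊨-cong (◇ᵍ φ) (s⊆t , t⊆s) (s' , lift (s'⊆Rs , s⊆R⁻s') , h) =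
    s' , lift ((λ v → image-mono s⊆t v ∘ s'⊆Rs v) , (λ w → s⊆R⁻s' w ∘ t⊆s w)) , h
  ⊨-cong (□ᵍ φ) (s⊆t , t⊆s) = ⊨-cong φ (image-mono s⊆t , image-mono t⊆s)

  unionClosed : ∀ {m b} (φ : Fm m b) → UnionClosedIn φ
  unionClosed (atom p) I i T h = lift (λ { w (j , x) → lower (h j) w x })
  unionClosed ⊥f I i T h = lift (λ { w (j , x) → lower (h j) w x })
  unionClosed (φ ∧f ψ) I i T h =
    unionClosed φ I i T (proj₁ ∘ h) , unionClosed ψ I i T (proj₂ ∘ h)
  unionClosed (φ ∨f ψ) I i T h =
    ⋃ A , ⋃ B , lift (⋃T⊆ , ⊆⋃T) , unionClosed φ I i A hA , unionClosed ψ I i B hB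
    where
    A B : I → Team M
    A j = proj₁ (h j)
    B j = proj₁ (proj₂ (h j))
    split : ∀ j → T j ≐ (A j ∪ B j)
    split j = lower (proj₁ (proj₂ (proj₂ (h j))))
    hA : ∀ j → M , A j ⊨ φ
    hA j = proj₁ (proj₂ (proj₂ (proj₂ (h j))))
    hB : ∀ j → M , B j ⊨ ψ
    hB j = proj₂ (proj₂ (proj₂ (proj₂ (h j))))
    ⋃T⊆ : ⋃ T ⊆ (⋃ A ∪ ⋃ B)
    ⋃T⊆ w (j , x) with proj₁ (split j) w x
    ... | inj₁ y = inj₁ (j , y)
    ... | inj₂ y = inj₂ (j , y)
    ⊆⋃T : (⋃ A ∪ ⋃ B) ⊆ ⋃ T
    ⊆⋃T w (inj₁ (j , y)) = j , proj₂ (split j) w (inj₁ y)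
    ⊆⋃T w (inj₂ (j , y)) = j , proj₂ (split j) w (inj₂ y)
  unionClosed (¬f α) I i T h w (j , x) = h j w x
  unionClosed NE I i T h = let (w , x) = lower (h i) in lift (w , i , x)
  unionClosed (◇ φ) I i T h w (j , x) = h j w x
  unionClosed (□ φ) I i T h w (j , x) = h j w x
  unionClosed (◇ᵍ φ) I i T h =
    ⋃ S , lift (⋃S⊆ , ⋃T⊆) , unionClosed φ I i S (proj₂ ∘ proj₂ ∘ h)
    where
    S : I → Team M
    S j = proj₁ (h j)
    related : ∀ j → TeamR (T j) (S j)
    related j = lower (proj₁ (proj₂ (h j)))
    ⋃S⊆ : ⋃ S ⊆ image (⋃ T)
    ⋃S⊆ v (j , x) = let (w , Tjw , wRv) = proj₁ (related j) v x in w , (j , Tjw) , wRv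
    ⋃T⊆ : ⋃ T ⊆ preimage (⋃ S)
    ⋃T⊆ w (j , x) = let (v , Sjv , wRv) = proj₂ (related j) w x in v , (j , Sjv) , wRv
  unionClosed (□ᵍ φ) I i T h =
    ⊨-cong φ (image-⋃ T) (unionClosed φ I i (image ∘ T) h)

  ⊨-∪ : ∀ {m b} (φ : Fm m b) {s t} → M , s ⊨ φ → M , t ⊨ φ → M , s ∪ t ⊨ φ
  ⊨-∪ φ {s} {t} hs ht =
    ⊨-cong φ (⋃-Bool s t) (unionClosed φ Bool true _ λ { true → hs ; false → ht })

  ⊨-∪-∩ : ∀ {m b} (φ : Fm m b) → ConvexIn φ → ∀ {s t} c →
          M , s ⊨ φ → M , t ⊨ φ → M , s ∪ (t ∩ c) ⊨ φ
  ⊨-∪-∩ φ convex-φ {s} {t} c hs ht =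
    convex-φ s (s ∪ (t ∩ c)) (s ∪ t) (λ _ → inj₁) ∪∩⊆∪ hs (⊨-∪ φ hs ht)
    where
    ∪∩⊆∪ : (s ∪ (t ∩ c)) ⊆ (s ∪ t)
    ∪∩⊆∪ w (inj₁ x) = inj₁ x
    ∪∩⊆∪ w (inj₂ (x , _)) = inj₂ x

  convex : ∀ {m b} (φ : Fm m b) → ConvexIn φ
  convex (atom p) s u t _ u⊆t _ (lift ht) = lift (λ w → ht w ∘ u⊆t w)
  convex ⊥f s u t _ u⊆t _ (lift ht) = lift (λ w → ht w ∘ u⊆t w)
  convex (φ ∧f ψ) s u t s⊆u u⊆t (hsφ , hsψ) (htφ , htψ) =
    convex φ s u t s⊆u u⊆t hsφ htφ , convex ψ s u t s⊆u u⊆t hsψ htψ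
  convex (φ ∨f ψ) s u t s⊆u u⊆t
         (s₁ , s₂ , lift (_ , ∪⊆s) , hs₁ , hs₂) (t₁ , t₂ , lift (t⊆∪ , _) , ht₁ , ht₂) =
    u₁ , u₂ , lift (u⊆∪ , ∪⊆u) , ⊨-∪-∩ φ (convex φ) u hs₁ ht₁ , ⊨-∪-∩ ψ (convex ψ) u hs₂ ht₂
    where
    u₁ u₂ : Team M
    u₁ = s₁ ∪ (t₁ ∩ u)
    u₂ = s₂ ∪ (t₂ ∩ u)
    u⊆∪ : u ⊆ (u₁ ∪ u₂)
    u⊆∪ w uw with t⊆∪ w (u⊆t w uw)
    ... | inj₁ x = inj₁ (inj₂ (x , uw))
    ... | inj₂ x = inj₂ (inj₂ (x , uw))
    ∪⊆u : (u₁ ∪ u₂) ⊆ u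
    ∪⊆u w (inj₁ (inj₁ x)) = s⊆u w (∪⊆s w (inj₁ x))
    ∪⊆u w (inj₁ (inj₂ (_ , uw))) = uw
    ∪⊆u w (inj₂ (inj₁ x)) = s⊆u w (∪⊆s w (inj₂ x))
    ∪⊆u w (inj₂ (inj₂ (_ , uw))) = uw
  convex (¬f α) s u t _ u⊆t _ ht w = ht w ∘ u⊆t w
  convex NE s u t s⊆u _ (lift (w , sw)) _ = lift (w , s⊆u w sw)
  convex (◇ φ) s u t _ u⊆t _ ht w = ht w ∘ u⊆t w
  convex (□ φ) s u t _ u⊆t _ ht w = ht w ∘ u⊆t w
  convex (◇ᵍ φ) s u t s⊆u u⊆t (s' , lift (s'⊆Rs , _) , hs) (t' , lift (_ , t⊆R⁻t') , ht) =
    u' , lift (u'⊆Ru , u⊆R⁻u') , ⊨-∪-∩ φ (convex φ) (image u) hs ht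
    where
    u' : Team M
    u' = s' ∪ (t' ∩ image u)
    u'⊆Ru : u' ⊆ image u
    u'⊆Ru v (inj₁ x) = image-mono s⊆u v (s'⊆Rs v x)
    u'⊆Ru v (inj₂ (_ , x)) = x
    u⊆R⁻u' : u ⊆ preimage u'
    u⊆R⁻u' w uw = let (v , t'v , wRv) = t⊆R⁻t' w (u⊆t w uw) in
                  v , inj₂ (t'v , w , uw , wRv) , wRv
  convex (□ᵍ φ) s u t s⊆u u⊆t =
    convex φ (image s) (image u) (image t) (image-mono s⊆u) (image-mono u⊆t)

proposition3p6 : ∀ (m : Mode) (φ : Fm m true) → Convex φ × UnionClosed φ
proposition3p6 m φ = (λ M → convex M φ) , (λ M → unionClosed M φ)
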